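{- Let $d\ge2$ be an integer and $N_1,\dots,N_d$ positive integers. Let $X\subseteq[N_1]\times\cdots\times[N_d]$ and let $\mathbf{b}=(b_1,\dots,b_d)\in\mathbb{Z}^d\setminus\{\mathbf{0}\}$ with $\lambda=\lambda(\mathbf{b}):=\max_{1\le i\le d}\frac{|b_i|}{\gcd(b_1,\dots,b_d)N_i}\le1$. Let $s^*\le s\le\min_iN_i$ be positive integers. Suppose $f_{\mathbf{b}}:\mathbb{Z}^d\to\mathbb{Z}^{d-1}$ is an affine map $\mathbf{x}\mapsto M\mathbf{x}+\mathbf{v}$ ($M\in\mathbb{Z}^{(d-1)\times d}$, $\mathbf{v}\in\mathbb{Z}^{d-1}$) such that for any $\mathbf{x}_1,\mathbf{x}_2\in\mathbb{Z}^d$, $f_{\mathbf{b}}(\mathbf{x}_1)=f_{\mathbf{b}}(\mathbf{x}_2)$ if and only if $\mathbf{x}_1-\mathbf{x}_2=k\mathbf{b}$ for some $k\in\mathbb{Q}$; and suppose $\mathbf{b}'\in\mathbb{Z}^d$ satisfies $f_{\mathbf{b}}(\mathbf{b}')\ne f_{\mathbf{b}}(\mathbf{0})$. Then \[ |U^d(X,\mathbf{b},s)\cap U^d(X,\mathbf{b}',s)|\le\frac{s^*-1}{s}|U^d(X,\mathbf{b}',s)|+\frac{2}{\lambda}\big|U^{d-1}\big(f_{\mathbf{b}}(U^d(X,\mathbf{b},s)),\,f_{\mathbf{b}}(\mathbf{b}')-f_{\mathbf{b}}(\mathbf{0}),\,s^*\big)\big|. \]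
   Context: $[n]=\{1,\dots,n\}$. For $\mathbf{b}\in\mathbb{Z}^k\setminus\{\mathbf{0}\}$, $\mathbf{x}\equiv\mathbf{x}'\pmod{\mathbf{b}}$ means $\mathbf{x}-\mathbf{x}'=t\mathbf{b}$ for some integer $t$. For a positive integer $s$, a finite $Y\subseteq\mathbb{Z}^k$ and $\mathbf{b}\in\mathbb{Z}^k\setminus\{\mathbf{0}\}$, $U^k(Y,\mathbf{b},s)$ is the set of $y\in Y$ with $|\{y'\in Y:y'\equiv y\pmod{\mathbf{b}}\}|\ge s$ (used here with $k=d$ and $k=d-1$). For a map $\phi$ and set $A$, $\phi(A)=\{\phi(a):a\in A\}$. -}

module Defs where

open import Data.Nat as ℕ using (ℕ; zero; suc)
open import Data.Nat.GCD using (gcd)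
open import Data.Integer as ℤ using (ℤ; +_; ∣_∣)
open import Data.Rational as ℚ using (ℚ; 0ℚ; _÷_; ≢-nonZero)
open import Data.Rational.Properties using () renaming (_≟_ to _≟ℚ_)
open import Data.Vec using (Vec; []; _∷_; zipWith; map; foldr; replicate)
open import Data.List using (List; length)
open import Data.List.Membership.Propositional using (_∈_)
open import Data.List.Relation.Unary.Unique.Propositional using (Unique)
open import Data.List.Relation.Unary.All using (All)
open import Data.Product using (Σ; _×_; ∃-syntax)
open import Relation.Binary.PropositionalEquality using (_≡_)
open import Relation.Nullary using (yes; no)
open import Function.Bundles using (_⇔_)
open import Data.Unit using (⊤)

Pt : ℕ → Set
Pt k = Vec ℤ k

_-ᵛ_ : ∀ {k} → Pt k → Pt k → Pt k
_-ᵛ_ = zipWith ℤ._-_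

_+ᵛ_ : ∀ {k} → Pt k → Pt k → Pt k
_+ᵛ_ = zipWith ℤ._+_

_·ᵛ_ : ∀ {k} → ℤ → Pt k → Pt k
t ·ᵛ b = map (t ℤ.*_) b

0ᵛ : ∀ {k} → Pt k
0ᵛ = replicate _ (+ 0)

CongMod : ∀ {k} → Pt k → Pt k → Pt k → Set
CongMod b x x' = Σ ℤ λ t → x -ᵛ x' ≡ t ·ᵛ b

-- U^k(Y,b,s) for a set Y ⊆ ℤ^k given as a predicate (finite in all uses):
-- y ∈ Y and there are at least s distinct y' ∈ Y with y' ≡ y (mod b).
InU : ∀ {k} → (Pt k → Set) → Pt k → ℕ → Pt k → Set
InU Y b s y = Y y × Σ (List (Pt _)) λ L →
  Unique L × All (λ y' → Y y' × CongMod b y' y) L × s ℕ.≤ length L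

HasCard : ∀ {A : Set} → (A → Set) → ℕ → Set
HasCard {A} P n = Σ (List A) λ L → Unique L × (∀ x → (x ∈ L) ⇔ P x) × length L ≡ n

Image : ∀ {A B : Set} → (A → B) → (A → Set) → B → Set
Image {A} φ P y = Σ A λ a → P a × φ a ≡ y

Mat : ℕ → ℕ → Set
Mat m n = Vec (Vec ℤ n) m

dot : ∀ {n} → Vec ℤ n → Vec ℤ n → ℤ
dot u w = foldr (λ _ → ℤ) ℤ._+_ (+ 0) (zipWith ℤ._*_ u w)

_*ᴹ_ : ∀ {m n} → Mat m n → Vec ℤ n → Vec ℤ m
M *ᴹ x = map (λ row → dot row x) M

affine : ∀ {m n} → Mat m n → Vec ℤ m → Pt n → Pt m
affine M v x = (M *ᴹ x) +ᵛ v

toℚ : ℤ → ℚ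
toℚ z = z ℚ./ 1

RatMultiple : ∀ {n} → Pt n → Pt n → Set
RatMultiple {n} w b = Σ ℚ λ k → map toℚ w ≡ map (k ℚ.*_) (map toℚ b)

-- rational division; the denominator is always nonzero where it is used
_÷'_ : ℚ → ℚ → ℚ
p ÷' q with q ≟ℚ 0ℚ
... | yes _ = 0ℚ
... | no q≢0 = _÷_ p q {{≢-nonZero q≢0}}

ℕtoℚ : ℕ → ℚ
ℕtoℚ n = toℚ (+ n)

-- gcd(b₁,…,b_d) (as a natural number; gcd with 0 is the identity)
gcdVec : ∀ {n} → Vec ℤ n → ℕ
gcdVec = foldr (λ _ → ℕ) (λ z acc → gcd ∣ z ∣ acc) 0

lambdaB : ∀ {n} → Vec ℤ n → Vec ℕ n → ℚ
lambdaB b N = foldr (λ _ → ℚ) ℚ._⊔_ 0ℚ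
  (zipWith (λ bi Ni → ℕtoℚ ∣ bi ∣ ÷' ℕtoℚ (gcdVec b ℕ.* Ni)) b N)

InBox : ∀ {n} → Vec ℕ n → Pt n → Set
InBox [] [] = ⊤
InBox (Ni ∷ N) (xi ∷ x) = (+ 1 ℤ.≤ xi × xi ℤ.≤ + Ni) × InBox N x

-- Split A = U(X,b,s) ∩ U(X,b',s) according to whether f(x) lies in
-- C = U(f(U(X,b,s)), c, s*), where c = f(b') − f(0).
--
-- If f(x) ∈ C: the fibres of f are lines of direction b, and such a line meets the box
-- in at most 2/λ points (read off the coordinate i at which λ(b) = |bᵢ|/(gcd(b)Nᵢ) is
-- attained: along the line it moves in steps of β = |bᵢ|/gcd(b) ≤ Nᵢ).  So there are at
-- most (2/λ)|C| such points.
--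
-- If f(x) ∉ C: x has a witness list of s points of X congruent to it mod b', all in
-- U(X,b',s).  A point y lies in the witness lists of fewer than s* such x: those x are
-- congruent mod b', f is injective on a class mod b' and maps it into a class of
-- f(U(X,b,s)) mod c, so s* of them would put their images in C.  Double counting the
-- pairs (x, y) gives s·#{f(x) ∉ C} ≤ (s*−1)|U(X,b',s)|.

module Submission where

open import Defs
open import Data.Nat as ℕ using (ℕ; zero; suc; _+_; _*_; _≤_; _∸_; z≤n; s≤s; NonZero)
open import Data.Integer as ℤ using (ℤ; +_; -[1+_]; ∣_∣; _⊖_)
open import Data.Rational as ℚ using (ℚ; mkℚ; ↥_; 0ℚ; 1ℚ)
open import Data.Vec as Vec using (Vec; []; _∷_; lookup; head; tail; zipWith; foldr)
open import Data.Fin using (Fin; zero; suc)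
open import Data.List as List using (List; []; _∷_; length; map; filter; upTo)
open import Data.List.Membership.Propositional using (_∈_)
open import Data.Product using (Σ; _×_; _,_; proj₁; proj₂)
open import Relation.Binary.PropositionalEquality using (_≡_; _≢_)
open import Function.Bundles using (_⇔_)

import Data.Nat.Properties as ℕ
import Data.Nat.Coprimality as ℕ
open import Data.Nat.Divisibility as ℕ using (_∣_; divides)
open import Data.Nat.GCD using (gcd[m,n]∣m; gcd[m,n]∣n; gcd-greatest; gcd[m,n]≡0⇒m≡0; gcd[m,n]≡0⇒n≡0; c*gcd[m,n]≡gcd[cm,cn])
open import Data.Nat.DivMod using (_/_; +-distrib-/-∣ʳ; m/n*n≡m; m/n*n≤m; /-monoˡ-≤)
open import Data.Nat.ListAction using (sum)
import Data.Integer.Properties as ℤ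
open import Data.Integer.Solver using (module +-*-Solver)
import Data.Rational.Properties as ℚ
import Data.Vec.Properties as Vec
import Data.List.Properties as List
open import Data.List.Membership.Propositional.Properties using (∈-filter⁺; ∈-filter⁻; ∈-map⁻; ∈-upTo⁺)
open import Data.List.Relation.Binary.Subset.Propositional using (_⊆_)
open import Data.List.Relation.Unary.Any using (here; there; _─_)
open import Data.List.Relation.Unary.All as All using (All)
import Data.List.Relation.Unary.All.Properties as AllP
open import Data.List.Relation.Unary.AllPairs using ([]; _∷_)
open import Data.List.Relation.Unary.Unique.Propositional using (Unique)
import Data.List.Relation.Unary.Unique.Propositional.Properties as Unique
open import Data.Sum using (inj₁; inj₂)
open import Algebra.Properties.CommutativeSemigroup ℕ.+-commutativeSemigroup using (interchange)
open import Function using (_∘_)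
open import Function.Bundles using (module Equivalence)
open import Relation.Nullary using (¬_; Dec; yes; no; contradiction)
open import Relation.Unary using (Decidable)
open import Relation.Unary.Properties using (∁?)
open import Relation.Binary.Definitions using (DecidableEquality)
open import Relation.Binary.PropositionalEquality using (refl; sym; trans; cong; cong₂; subst; subst₂; module ≡-Reasoning)

open Equivalence using (to; from)
open +-*-Solver using (solve; _:+_; _:-_; _:*_; :-_; _:=_)

-- Counting in finite lists

module _ {A : Set} where

  ∈-─⁺ : ∀ {x y : A} {xs} (x∈xs : x ∈ xs) → y ∈ xs → y ≢ x → y ∈ (xs ─ x∈xs)
  ∈-─⁺ (here refl) (here refl) y≢x = contradiction refl y≢x
  ∈-─⁺ (here _)    (there y∈xs) _ = y∈xs
  ∈-─⁺ (there _)   (here refl)  _ = here refl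
  ∈-─⁺ (there x∈xs) (there y∈xs) y≢x = there (∈-─⁺ x∈xs y∈xs y≢x)

  Unique-⊆⇒length≤ : ∀ {xs ys : List A} → Unique xs → xs ⊆ ys → length xs ≤ length ys
  Unique-⊆⇒length≤ {[]} _ _ = z≤n
  Unique-⊆⇒length≤ {x ∷ xs} {ys} (x∉xs ∷ xs!) xs⊆ys = begin
    suc (length xs)              ≤⟨ s≤s (Unique-⊆⇒length≤ xs! xs⊆ys─x) ⟩
    suc (length (ys ─ x∈ys))     ≡⟨ List.length-removeAt′ ys _ ⟨
    length ys                    ∎
    where
    open ℕ.≤-Reasoning
    x∈ys = xs⊆ys (here refl)
    xs⊆ys─x : xs ⊆ (ys ─ x∈ys)
    xs⊆ys─x z∈xs = ∈-─⁺ x∈ys (xs⊆ys (there z∈xs)) λ { refl → All.lookup x∉xs z∈xs refl }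

module _ {A B : Set} (f : A → B) where

  Unique-map⁺-on : ∀ {xs} → (∀ {x y} → x ∈ xs → y ∈ xs → f x ≡ f y → x ≡ y) → Unique xs → Unique (map f xs)
  Unique-map⁺-on {[]}     _     _            = []
  Unique-map⁺-on {x ∷ xs} f-inj (x∉xs ∷ xs!) =
    AllP.map⁺ (All.tabulate (λ y∈xs fx≡fy → All.lookup x∉xs y∈xs (f-inj (here refl) (there y∈xs) fx≡fy)))
    ∷ Unique-map⁺-on (λ x∈xs y∈xs → f-inj (there x∈xs) (there y∈xs)) xs!

module _ {A : Set} where

  sum-map-≥ : ∀ (f : A → ℕ) {p} xs → (∀ {x} → x ∈ xs → p ≤ f x) → p * length xs ≤ sum (map f xs)
  sum-map-≥ f {p} []       _  = ℕ.≤-reflexive (ℕ.*-zeroʳ p)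
  sum-map-≥ f {p} (x ∷ xs) lb = subst (_≤ sum (map f (x ∷ xs))) (sym (ℕ.*-suc p (length xs)))
    (ℕ.+-mono-≤ (lb (here refl)) (sum-map-≥ f xs (lb ∘ there)))

  sum-map-≤ : ∀ (f : A → ℕ) {q} xs → (∀ {x} → x ∈ xs → f x ≤ q) → sum (map f xs) ≤ q * length xs
  sum-map-≤ f {q} []       _  = ℕ.≤-reflexive (sym (ℕ.*-zeroʳ q))
  sum-map-≤ f {q} (x ∷ xs) ub = subst (sum (map f (x ∷ xs)) ≤_) (sym (ℕ.*-suc q (length xs)))
    (ℕ.+-mono-≤ (ub (here refl)) (sum-map-≤ f xs (ub ∘ there)))

  sum-map-+ : ∀ (f g : A → ℕ) xs → sum (map (λ x → f x + g x) xs) ≡ sum (map f xs) + sum (map g xs)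
  sum-map-+ f g []       = refl
  sum-map-+ f g (x ∷ xs) = trans (cong (_+_ (f x + g x)) (sum-map-+ f g xs)) (interchange (f x) (g x) _ _)

  sum-map-0 : ∀ (xs : List A) → sum (map (λ _ → 0) xs) ≡ 0
  sum-map-0 []       = refl
  sum-map-0 (_ ∷ xs) = sum-map-0 xs

module _ {A B : Set} {R : A → B → Set} (R? : ∀ x y → Dec (R x y)) where

  degree : List B → A → ℕ
  degree ys x = length (filter (R? x) ys)

  codegree : List A → B → ℕ
  codegree xs y = length (filter (λ x → R? x y) xs)

  private
    indicator : ∀ x y → ℕ
    indicator x y with R? x y
    ... | yes _ = 1
    ... | no _  = 0

    codegree-∷ : ∀ x xs y → codegree (x ∷ xs) y ≡ indicator x y + codegree xs y
    codegree-∷ x xs y with R? x y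
    ... | yes _ = refl
    ... | no _  = refl

    degree≡sum-indicator : ∀ x ys → degree ys x ≡ sum (map (indicator x) ys)
    degree≡sum-indicator x [] = refl
    degree≡sum-indicator x (y ∷ ys) with R? x y
    ... | yes _ = cong suc (degree≡sum-indicator x ys)
    ... | no _  = degree≡sum-indicator x ys

  double-counting : ∀ xs ys → sum (map (degree ys) xs) ≡ sum (map (codegree xs) ys)
  double-counting []       ys = sym (sum-map-0 ys)
  double-counting (x ∷ xs) ys = begin
    degree ys x + sum (map (degree ys) xs)                   ≡⟨ cong₂ _+_ (degree≡sum-indicator x ys) (double-counting xs ys) ⟩
    sum (map (indicator x) ys) + sum (map (codegree xs) ys)  ≡⟨ sum-map-+ (indicator x) (codegree xs) ys ⟨
    sum (map (λ y → indicator x y + codegree xs y) ys)       ≡⟨ cong sum (List.map-cong (codegree-∷ x xs) ys) ⟨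
    sum (map (codegree (x ∷ xs)) ys)                         ∎
    where open ≡-Reasoning

  incidence-bound : ∀ {p q} xs ys → (∀ {x} → x ∈ xs → p ≤ degree ys x) → (∀ {y} → y ∈ ys → codegree xs y ≤ q) →
                    p * length xs ≤ q * length ys
  incidence-bound {p} {q} xs ys deg≥p codeg≤q = begin
    p * length xs                   ≤⟨ sum-map-≥ (degree ys) xs deg≥p ⟩
    sum (map (degree ys) xs)        ≡⟨ double-counting xs ys ⟩
    sum (map (codegree xs) ys)      ≤⟨ sum-map-≤ (codegree xs) ys codeg≤q ⟩
    q * length ys                   ∎
    where open ℕ.≤-Reasoning

module _ {A : Set} {P : A → Set} (P? : Decidable P) where

  length-filter+filter-∁ : ∀ xs → length xs ≡ length (filter P? xs) + length (filter (∁? P?) xs)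
  length-filter+filter-∁ []       = refl
  length-filter+filter-∁ (x ∷ xs) with P? x
  ... | yes _ = cong suc (length-filter+filter-∁ xs)
  ... | no _  = trans (cong suc (length-filter+filter-∁ xs)) (sym (ℕ.+-suc _ _))

module _ {A B : Set} (_≟_ : DecidableEquality A) {P : A → B → Set} where

  open import Data.List.Membership.DecPropositional _≟_ using (_∈?_)

  choice-on-list : B → ∀ {xs} → (∀ {x} → x ∈ xs → Σ B (P x)) → Σ (A → B) λ g → ∀ {x} → x ∈ xs → P x (g x)
  choice-on-list default {xs} choose = g , P[g]
    where
    g : A → B
    g x with x ∈? xs
    ... | yes x∈xs = proj₁ (choose x∈xs)
    ... | no _     = default
    P[g] : ∀ {x} → x ∈ xs → P x (g x)
    P[g] {x} x∈xs with x ∈? xs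
    ... | yes x∈xs′ = proj₂ (choose x∈xs′)
    ... | no x∉xs   = contradiction x∈xs x∉xs

module _ {A B : Set} (_≟_ : DecidableEquality B) (g : A → B) where

  length≤fibre*length : ∀ {k} xs ys → (∀ {x} → x ∈ xs → g x ∈ ys) →
                        (∀ y → length (filter (λ x → g x ≟ y) xs) ≤ k) → length xs ≤ k * length ys
  length≤fibre*length {k} xs ys g[xs]⊆ys fibre≤k = subst (_≤ k * length ys) (ℕ.*-identityˡ (length xs))
    (incidence-bound (λ x y → g x ≟ y) xs ys (λ x∈xs → List.filter-some (g _ ≟_) (g[xs]⊆ys x∈xs)) (λ {y} _ → fibre≤k y))

-- Integer vectors and affine maps

_≟ᵛ_ : ∀ {k} → DecidableEquality (Pt k)
_≟ᵛ_ = Vec.≡-dec ℤ._≟_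

x-ᵛx≡0ᵛ : ∀ {k} (x : Pt k) → x -ᵛ x ≡ 0ᵛ
x-ᵛx≡0ᵛ []      = refl
x-ᵛx≡0ᵛ (a ∷ x) = cong₂ _∷_ (ℤ.+-inverseʳ a) (x-ᵛx≡0ᵛ x)

x-ᵛ0ᵛ≡x : ∀ {k} (x : Pt k) → x -ᵛ 0ᵛ ≡ x
x-ᵛ0ᵛ≡x []      = refl
x-ᵛ0ᵛ≡x (a ∷ x) = cong₂ _∷_ (ℤ.+-identityʳ a) (x-ᵛ0ᵛ≡x x)

x-ᵛy≡0ᵛ⇒x≡y : ∀ {k} {x y : Pt k} → x -ᵛ y ≡ 0ᵛ → x ≡ y
x-ᵛy≡0ᵛ⇒x≡y {x = []}    {[]}    _ = refl
x-ᵛy≡0ᵛ⇒x≡y {x = a ∷ x} {c ∷ y} e = cong₂ _∷_ (ℤ.i-j≡0⇒i≡j a c (cong head e)) (x-ᵛy≡0ᵛ⇒x≡y (cong tail e))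

0·ᵛx≡0ᵛ : ∀ {k} (x : Pt k) → (+ 0) ·ᵛ x ≡ 0ᵛ
0·ᵛx≡0ᵛ []      = refl
0·ᵛx≡0ᵛ (a ∷ x) = cong (+ 0 ∷_) (0·ᵛx≡0ᵛ x)

t·ᵛx≡0ᵛ⇒t≡0 : ∀ {k} t {x : Pt k} → x ≢ 0ᵛ → t ·ᵛ x ≡ 0ᵛ → t ≡ + 0
t·ᵛx≡0ᵛ⇒t≡0 t {[]}    x≢0 _ = contradiction refl x≢0
t·ᵛx≡0ᵛ⇒t≡0 t {a ∷ x} x≢0 e with ℤ.i*j≡0⇒i≡0∨j≡0 t (cong head e)
... | inj₁ t≡0 = t≡0
... | inj₂ a≡0 = t·ᵛx≡0ᵛ⇒t≡0 t (λ x≡0 → x≢0 (cong₂ _∷_ a≡0 x≡0)) (cong tail e)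

CongMod-sym : ∀ {k} {b x y : Pt k} → CongMod b x y → CongMod b y x
CongMod-sym {b = b} {x} {y} (t , e) = ℤ.- t , componentwise b x y e
  where
  componentwise : ∀ {k} (b x y : Pt k) → x -ᵛ y ≡ t ·ᵛ b → y -ᵛ x ≡ (ℤ.- t) ·ᵛ b
  componentwise []      []      []      _ = refl
  componentwise (β ∷ b) (a ∷ x) (c ∷ y) e = cong₂ _∷_ (begin
    c ℤ.- a           ≡⟨ solve 2 (λ a c → c :- a := :- (a :- c)) refl a c ⟩
    ℤ.- (a ℤ.- c)     ≡⟨ cong ℤ.-_ (cong head e) ⟩
    ℤ.- (t ℤ.* β)     ≡⟨ ℤ.neg-distribˡ-* t β ⟩
    ℤ.- t ℤ.* β       ∎) (componentwise b x y (cong tail e))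
    where open ≡-Reasoning

CongMod-trans : ∀ {k} {b x y z : Pt k} → CongMod b x y → CongMod b y z → CongMod b x z
CongMod-trans {b = b} {x} {y} {z} (t , e) (u , e′) = t ℤ.+ u , componentwise b x y z e e′
  where
  componentwise : ∀ {k} (b x y z : Pt k) → x -ᵛ y ≡ t ·ᵛ b → y -ᵛ z ≡ u ·ᵛ b → x -ᵛ z ≡ (t ℤ.+ u) ·ᵛ b
  componentwise []      []      []      []      _ _ = refl
  componentwise (β ∷ b) (a ∷ x) (c ∷ y) (w ∷ z) e e′ = cong₂ _∷_ (begin
    a ℤ.- w                     ≡⟨ solve 3 (λ a c w → a :- w := (a :- c) :+ (c :- w)) refl a c w ⟩
    (a ℤ.- c) ℤ.+ (c ℤ.- w)     ≡⟨ cong₂ ℤ._+_ (cong head e) (cong head e′) ⟩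
    t ℤ.* β ℤ.+ u ℤ.* β         ≡⟨ ℤ.*-distribʳ-+ β t u ⟨
    (t ℤ.+ u) ℤ.* β             ∎) (componentwise b x y z (cong tail e) (cong tail e′))
    where open ≡-Reasoning

dot-distrib-ᵛ : ∀ {k} (r x y : Pt k) → dot r (x -ᵛ y) ≡ dot r x ℤ.- dot r y
dot-distrib-ᵛ []      []      []      = refl
dot-distrib-ᵛ (ρ ∷ r) (a ∷ x) (c ∷ y) = trans (cong (ℤ._+_ (ρ ℤ.* (a ℤ.- c))) (dot-distrib-ᵛ r x y))
  (solve 5 (λ ρ a c p q → ρ :* (a :- c) :+ (p :- q) := (ρ :* a :+ p) :- (ρ :* c :+ q)) refl ρ a c (dot r x) (dot r y))

dot-·ᵛ : ∀ {k} (r x : Pt k) t → dot r (t ·ᵛ x) ≡ t ℤ.* dot r x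
dot-·ᵛ []      []      t = sym (ℤ.*-zeroʳ t)
dot-·ᵛ (ρ ∷ r) (a ∷ x) t = trans (cong (ℤ._+_ (ρ ℤ.* (t ℤ.* a))) (dot-·ᵛ r x t))
  (solve 4 (λ ρ a t p → ρ :* (t :* a) :+ t :* p := t :* (ρ :* a :+ p)) refl ρ a t (dot r x))

*ᴹ-distrib-ᵛ : ∀ {m n} (M : Mat m n) x y → M *ᴹ (x -ᵛ y) ≡ (M *ᴹ x) -ᵛ (M *ᴹ y)
*ᴹ-distrib-ᵛ []      x y = refl
*ᴹ-distrib-ᵛ (r ∷ M) x y = cong₂ _∷_ (dot-distrib-ᵛ r x y) (*ᴹ-distrib-ᵛ M x y)

*ᴹ-·ᵛ : ∀ {m n} (M : Mat m n) x t → M *ᴹ (t ·ᵛ x) ≡ t ·ᵛ (M *ᴹ x)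
*ᴹ-·ᵛ []      x t = refl
*ᴹ-·ᵛ (r ∷ M) x t = cong₂ _∷_ (dot-·ᵛ r x t) (*ᴹ-·ᵛ M x t)

affine-ᵛ-affine : ∀ {m n} (M : Mat m n) v (x y : Pt n) → affine M v x -ᵛ affine M v y ≡ M *ᴹ (x -ᵛ y)
affine-ᵛ-affine M v x y = trans (cancel (M *ᴹ x) (M *ᴹ y) v) (sym (*ᴹ-distrib-ᵛ M x y))
  where
  cancel : ∀ {k} (p q v : Pt k) → (p +ᵛ v) -ᵛ (q +ᵛ v) ≡ p -ᵛ q
  cancel []      []      []      = refl
  cancel (a ∷ p) (c ∷ q) (w ∷ v) =
    cong₂ _∷_ (solve 3 (λ a c w → (a :+ w) :- (c :+ w) := a :- c) refl a c w) (cancel p q v)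

affine-b-affine-0 : ∀ {m n} (M : Mat m n) v (b : Pt n) → affine M v b -ᵛ affine M v 0ᵛ ≡ M *ᴹ b
affine-b-affine-0 M v b = trans (affine-ᵛ-affine M v b 0ᵛ) (cong (M *ᴹ_) (x-ᵛ0ᵛ≡x b))

module _ {m n} (M : Mat m n) (v : Pt m) {b : Pt n} where

  affine-CongMod : ∀ {x y} → CongMod b x y → CongMod (affine M v b -ᵛ affine M v 0ᵛ) (affine M v x) (affine M v y)
  affine-CongMod {x} {y} (t , x-y≡tb) = t , (begin
    affine M v x -ᵛ affine M v y        ≡⟨ affine-ᵛ-affine M v x y ⟩
    M *ᴹ (x -ᵛ y)                       ≡⟨ cong (M *ᴹ_) x-y≡tb ⟩
    M *ᴹ (t ·ᵛ b)                       ≡⟨ *ᴹ-·ᵛ M b t ⟩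
    t ·ᵛ (M *ᴹ b)                       ≡⟨ cong (t ·ᵛ_) (affine-b-affine-0 M v b) ⟨
    t ·ᵛ (affine M v b -ᵛ affine M v 0ᵛ) ∎)
    where open ≡-Reasoning

  affine-injective-on-CongMod : affine M v b ≢ affine M v 0ᵛ → ∀ {x y} → CongMod b x y →
                                affine M v x ≡ affine M v y → x ≡ y
  affine-injective-on-CongMod fb≢f0 {x} {y} (t , x-y≡tb) fx≡fy = x-ᵛy≡0ᵛ⇒x≡y (begin
    x -ᵛ y          ≡⟨ x-y≡tb ⟩
    t ·ᵛ b          ≡⟨ cong (_·ᵛ b) (t·ᵛx≡0ᵛ⇒t≡0 t (fb≢f0 ∘ x-ᵛy≡0ᵛ⇒x≡y) t·c≡0) ⟩
    (+ 0) ·ᵛ b      ≡⟨ 0·ᵛx≡0ᵛ b ⟩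
    0ᵛ              ∎)
    where
    open ≡-Reasoning
    t·c≡0 : t ·ᵛ (affine M v b -ᵛ affine M v 0ᵛ) ≡ 0ᵛ
    t·c≡0 = begin
      t ·ᵛ (affine M v b -ᵛ affine M v 0ᵛ) ≡⟨ proj₂ (affine-CongMod (t , x-y≡tb)) ⟨
      affine M v x -ᵛ affine M v y         ≡⟨ cong (_-ᵛ affine M v y) fx≡fy ⟩
      affine M v y -ᵛ affine M v y         ≡⟨ x-ᵛx≡0ᵛ (affine M v y) ⟩
      0ᵛ                                   ∎

-- ℕ and ℤ inside ℚ

toℚ≡mkℚ : ∀ z → toℚ z ≡ mkℚ z 0 (ℕ.sym (ℕ.1-coprimeTo ∣ z ∣))
toℚ≡mkℚ (+ n)    = ℚ.normalize-coprime (ℕ.sym (ℕ.1-coprimeTo n))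
toℚ≡mkℚ -[1+ n ] = cong ℚ.-_ (ℚ.normalize-coprime (ℕ.sym (ℕ.1-coprimeTo (suc n))))

toℚ-injective : ∀ {i j} → toℚ i ≡ toℚ j → i ≡ j
toℚ-injective {i} {j} eq = begin
  i             ≡⟨ cong ↥_ (toℚ≡mkℚ i) ⟨
  ↥ toℚ i       ≡⟨ cong ↥_ eq ⟩
  ↥ toℚ j       ≡⟨ cong ↥_ (toℚ≡mkℚ j) ⟩
  j             ∎
  where open ≡-Reasoning

-- In the form mkℚ _ 0 _ the product computes to (i * j) / 1 on the nose.
toℚ-* : ∀ i j → toℚ (i ℤ.* j) ≡ toℚ i ℚ.* toℚ j
toℚ-* i j rewrite toℚ≡mkℚ i | toℚ≡mkℚ j = refl

toℚ-+ : ∀ i j → toℚ (i ℤ.+ j) ≡ toℚ i ℚ.+ toℚ j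
toℚ-+ i j rewrite toℚ≡mkℚ i | toℚ≡mkℚ j = cong toℚ (cong₂ ℤ._+_ (sym (ℤ.*-identityʳ i)) (sym (ℤ.*-identityʳ j)))

toℚ-mono-≤ : ∀ {i j} → i ℤ.≤ j → toℚ i ℚ.≤ toℚ j
toℚ-mono-≤ {i} {j} i≤j rewrite toℚ≡mkℚ i | toℚ≡mkℚ j = ℚ.*≤* (subst₂ ℤ._≤_ (sym (ℤ.*-identityʳ i)) (sym (ℤ.*-identityʳ j)) i≤j)

toℚ-cancel-≤ : ∀ {i j} → toℚ i ℚ.≤ toℚ j → i ℤ.≤ j
toℚ-cancel-≤ {i} {j} le with subst₂ ℚ._≤_ (toℚ≡mkℚ i) (toℚ≡mkℚ j) le
... | ℚ.*≤* i*1≤j*1 = subst₂ ℤ._≤_ (ℤ.*-identityʳ i) (ℤ.*-identityʳ j) i*1≤j*1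

toℚ-mono-< : ∀ {i j} → i ℤ.< j → toℚ i ℚ.< toℚ j
toℚ-mono-< {i} {j} i<j rewrite toℚ≡mkℚ i | toℚ≡mkℚ j = ℚ.*<* (subst₂ ℤ._<_ (sym (ℤ.*-identityʳ i)) (sym (ℤ.*-identityʳ j)) i<j)

ℕtoℚ-+ : ∀ m n → ℕtoℚ (m ℕ.+ n) ≡ ℕtoℚ m ℚ.+ ℕtoℚ n
ℕtoℚ-+ m n = trans (cong toℚ (ℤ.pos-+ m n)) (toℚ-+ (+ m) (+ n))

ℕtoℚ-* : ∀ m n → ℕtoℚ (m ℕ.* n) ≡ ℕtoℚ m ℚ.* ℕtoℚ n
ℕtoℚ-* m n = trans (cong toℚ (ℤ.pos-* m n)) (toℚ-* (+ m) (+ n))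

ℕtoℚ-mono-≤ : ∀ {m n} → m ℕ.≤ n → ℕtoℚ m ℚ.≤ ℕtoℚ n
ℕtoℚ-mono-≤ m≤n = toℚ-mono-≤ (ℤ.+≤+ m≤n)

ℕtoℚ-cancel-≤ : ∀ {m n} → ℕtoℚ m ℚ.≤ ℕtoℚ n → m ℕ.≤ n
ℕtoℚ-cancel-≤ le = ℤ.drop‿+≤+ (toℚ-cancel-≤ le)

ℕtoℚ-nonNeg : ∀ n → 0ℚ ℚ.≤ ℕtoℚ n
ℕtoℚ-nonNeg n = ℕtoℚ-mono-≤ {0} {n} ℕ.z≤n

ℕtoℚ-pos : ∀ {n} → n ≢ 0 → 0ℚ ℚ.< ℕtoℚ n
ℕtoℚ-pos {zero}  n≢0 = contradiction refl n≢0
ℕtoℚ-pos {suc n} _   = toℚ-mono-< {+ 0} {+ suc n} (ℤ.+<+ (ℕ.s≤s ℕ.z≤n))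

0÷'q≡0 : ∀ q → 0ℚ ÷' q ≡ 0ℚ
0÷'q≡0 q with q ℚ.≟ 0ℚ
... | yes _   = refl
... | no q≢0  = ℚ.*-zeroˡ (ℚ.1/_ q {{ℚ.≢-nonZero q≢0}})

module _ {q : ℚ} (0<q : 0ℚ ℚ.< q) where

  private instance
    q-pos : ℚ.Positive q
    q-pos = ℚ.positive 0<q
    q≢0 : ℚ.NonZero q
    q≢0 = ℚ.pos⇒nonZero q
    q-nonNeg : ℚ.NonNegative q
    q-nonNeg = ℚ.pos⇒nonNeg q

  ÷'≡*1/ : ∀ p → p ÷' q ≡ p ℚ.* ℚ.1/ q
  ÷'≡*1/ p with q ℚ.≟ 0ℚ
  ... | yes q≡0 = contradiction (sym q≡0) (ℚ.<⇒≢ 0<q)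
  ... | no _    = refl

  ÷'-*-cancel : ∀ p → (p ÷' q) ℚ.* q ≡ p
  ÷'-*-cancel p = begin
    (p ÷' q) ℚ.* q         ≡⟨ cong (ℚ._* q) (÷'≡*1/ p) ⟩
    p ℚ.* ℚ.1/ q ℚ.* q     ≡⟨ ℚ.*-assoc p (ℚ.1/ q) q ⟩
    p ℚ.* (ℚ.1/ q ℚ.* q)   ≡⟨ cong (p ℚ.*_) (ℚ.*-inverseˡ q) ⟩
    p ℚ.* 1ℚ               ≡⟨ ℚ.*-identityʳ p ⟩
    p                      ∎
    where open ≡-Reasoning

  ÷'-*-comm : ∀ p r → (p ÷' q) ℚ.* r ≡ (p ℚ.* r) ÷' q
  ÷'-*-comm p r = begin
    (p ÷' q) ℚ.* r         ≡⟨ cong (ℚ._* r) (÷'≡*1/ p) ⟩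
    p ℚ.* ℚ.1/ q ℚ.* r     ≡⟨ ℚ.*-assoc p (ℚ.1/ q) r ⟩
    p ℚ.* (ℚ.1/ q ℚ.* r)   ≡⟨ cong (p ℚ.*_) (ℚ.*-comm (ℚ.1/ q) r) ⟩
    p ℚ.* (r ℚ.* ℚ.1/ q)   ≡⟨ ℚ.*-assoc p r (ℚ.1/ q) ⟨
    p ℚ.* r ℚ.* ℚ.1/ q     ≡⟨ ÷'≡*1/ (p ℚ.* r) ⟨
    (p ℚ.* r) ÷' q         ∎
    where open ≡-Reasoning

  *≤⇒≤÷' : ∀ {p r} → p ℚ.* q ℚ.≤ r → p ℚ.≤ r ÷' q
  *≤⇒≤÷' {p} {r} pq≤r = ℚ.*-cancelʳ-≤-pos q (subst (p ℚ.* q ℚ.≤_) (sym (÷'-*-cancel r)) pq≤r)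

  ≤*⇒÷'≤ : ∀ {p r} → p ℚ.≤ r ℚ.* q → p ÷' q ℚ.≤ r
  ≤*⇒÷'≤ {p} {r} p≤rq = ℚ.*-cancelʳ-≤-pos q (subst (ℚ._≤ r ℚ.* q) (sym (÷'-*-cancel p)) p≤rq)

  ÷'≤⇒≤* : ∀ {p r} → p ÷' q ℚ.≤ r → p ℚ.≤ r ℚ.* q
  ÷'≤⇒≤* {p} {r} p/q≤r = subst (ℚ._≤ r ℚ.* q) (÷'-*-cancel p) (ℚ.*-monoʳ-≤-nonNeg q p/q≤r)

  ÷'-pos : ∀ {p} → 0ℚ ℚ.< p → 0ℚ ℚ.< p ÷' q
  ÷'-pos {p} 0<p = ℚ.*-cancelʳ-<-nonNeg q (subst₂ ℚ._<_ (sym (ℚ.*-zeroˡ q)) (sym (÷'-*-cancel p)) 0<p)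

ℕtoℚ-≤-÷'* : ∀ {a c y n} → c ≢ 0 → c ℕ.* a ℕ.≤ y ℕ.* n → ℕtoℚ a ℚ.≤ (ℕtoℚ y ÷' ℕtoℚ c) ℚ.* ℕtoℚ n
ℕtoℚ-≤-÷'* {a} {c} {y} {n} c≢0 ca≤yn = subst (ℕtoℚ a ℚ.≤_) (sym (÷'-*-comm 0<c (ℕtoℚ y) (ℕtoℚ n)))
  (*≤⇒≤÷' 0<c (begin
    ℕtoℚ a ℚ.* ℕtoℚ c     ≡⟨ ℕtoℚ-* a c ⟨
    ℕtoℚ (a ℕ.* c)        ≤⟨ ℕtoℚ-mono-≤ (subst (ℕ._≤ y ℕ.* n) (ℕ.*-comm c a) ca≤yn) ⟩
    ℕtoℚ (y ℕ.* n)        ≡⟨ ℕtoℚ-* y n ⟩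
    ℕtoℚ y ℚ.* ℕtoℚ n     ∎))
  where
  open ℚ.≤-Reasoning
  0<c = ℕtoℚ-pos c≢0

ℕtoℚ-≤-* : ∀ {a m n r} → a ℕ.≤ m ℕ.* n → ℕtoℚ m ℚ.≤ r → ℕtoℚ a ℚ.≤ r ℚ.* ℕtoℚ n
ℕtoℚ-≤-* {a} {m} {n} {r} a≤mn m≤r = begin
  ℕtoℚ a              ≤⟨ ℕtoℚ-mono-≤ a≤mn ⟩
  ℕtoℚ (m ℕ.* n)      ≡⟨ ℕtoℚ-* m n ⟩
  ℕtoℚ m ℚ.* ℕtoℚ n   ≤⟨ ℚ.*-monoʳ-≤-nonNeg (ℕtoℚ n) {{ℚ.nonNegative (ℕtoℚ-nonNeg n)}} m≤r ⟩
  r ℚ.* ℕtoℚ n        ∎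
  where open ℚ.≤-Reasoning

-- gcd(b) and λ(b)

gcdVec-∣-lookup : ∀ {n} (b : Vec ℤ n) i → gcdVec b ∣ ∣ lookup b i ∣
gcdVec-∣-lookup (z ∷ b) zero    = gcd[m,n]∣m ∣ z ∣ (gcdVec b)
gcdVec-∣-lookup (z ∷ b) (suc i) = ℕ.∣-trans (gcd[m,n]∣n ∣ z ∣ (gcdVec b)) (gcdVec-∣-lookup b i)

∣-*-gcdVec : ∀ {n} (b : Vec ℤ n) {a} c → (∀ i → a ∣ c ℕ.* ∣ lookup b i ∣) → a ∣ c ℕ.* gcdVec b
∣-*-gcdVec []      {a} c _   = subst (a ∣_) (sym (ℕ.*-zeroʳ c)) (a ℕ.∣0)
∣-*-gcdVec (z ∷ b) {a} c a∣ = subst (a ∣_) (sym (c*gcd[m,n]≡gcd[cm,cn] c ∣ z ∣ (gcdVec b)))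
  (gcd-greatest (a∣ zero) (∣-*-gcdVec b c (λ i → a∣ (suc i))))

gcdVec≡0⇒≡0ᵛ : ∀ {n} (b : Vec ℤ n) → gcdVec b ≡ 0 → b ≡ 0ᵛ
gcdVec≡0⇒≡0ᵛ []      _ = refl
gcdVec≡0⇒≡0ᵛ (z ∷ b) g≡0 =
  cong₂ _∷_ (ℤ.∣i∣≡0⇒i≡0 (gcd[m,n]≡0⇒m≡0 g≡0)) (gcdVec≡0⇒≡0ᵛ b (gcd[m,n]≡0⇒n≡0 ∣ z ∣ g≡0))

maxℚ : ∀ {n} → Vec ℚ n → ℚ
maxℚ = foldr (λ _ → ℚ) ℚ._⊔_ 0ℚ

lookup≤maxℚ : ∀ {n} (v : Vec ℚ n) i → lookup v i ℚ.≤ maxℚ v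
lookup≤maxℚ (q ∷ v) zero    = ℚ.p≤p⊔q q (maxℚ v)
lookup≤maxℚ (q ∷ v) (suc i) = ℚ.p≤q⇒p≤r⊔q q (lookup≤maxℚ v i)

maxℚ-attained : ∀ {n} (v : Vec ℚ n) → 0ℚ ℚ.< maxℚ v → Σ (Fin n) λ i → maxℚ v ≡ lookup v i
maxℚ-attained []      0<0 = contradiction refl (ℚ.<⇒≢ 0<0)
maxℚ-attained (q ∷ v) 0<max with ℚ.⊔-sel q (maxℚ v)
... | inj₁ max≡q = zero , max≡q
... | inj₂ max≡max-v with maxℚ-attained v (subst (0ℚ ℚ.<_) max≡max-v 0<max)
...   | i , eq = suc i , trans max≡max-v eq

≢0ᵛ⇒lookup≢0 : ∀ {n} (b : Pt n) → b ≢ 0ᵛ → Σ (Fin n) λ i → lookup b i ≢ + 0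
≢0ᵛ⇒lookup≢0 []      b≢0 = contradiction refl b≢0
≢0ᵛ⇒lookup≢0 (z ∷ b) b≢0 with z ℤ.≟ + 0
... | no z≢0  = zero , z≢0
... | yes z≡0 with ≢0ᵛ⇒lookup≢0 b (λ b≡0 → b≢0 (cong₂ _∷_ z≡0 b≡0))
...   | i , bᵢ≢0 = suc i , bᵢ≢0

module _ {n} (b : Pt n) (N : Vec ℕ n) where

  λ-terms : Vec ℚ n
  λ-terms = zipWith (λ bi Ni → ℕtoℚ ∣ bi ∣ ÷' ℕtoℚ (gcdVec b ℕ.* Ni)) b N

  lookup-λ-terms : ∀ i → lookup λ-terms i ≡ ℕtoℚ ∣ lookup b i ∣ ÷' ℕtoℚ (gcdVec b ℕ.* lookup N i)
  lookup-λ-terms i = Vec.lookup-zipWith _ i b N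

  gcdVec*lookup≢0 : b ≢ 0ᵛ → ∀ {i} → 1 ≤ lookup N i → gcdVec b ℕ.* lookup N i ≢ 0
  gcdVec*lookup≢0 b≢0 Nᵢ≥1 gNᵢ≡0 with ℕ.m*n≡0⇒m≡0∨n≡0 (gcdVec b) gNᵢ≡0
  ... | inj₁ g≡0  = b≢0 (gcdVec≡0⇒≡0ᵛ b g≡0)
  ... | inj₂ Nᵢ≡0 = ℕ.<⇒≢ Nᵢ≥1 (sym Nᵢ≡0)

  lambdaB-pos : b ≢ 0ᵛ → (∀ i → 1 ≤ lookup N i) → 0ℚ ℚ.< lambdaB b N
  lambdaB-pos b≢0 N≥1 = ℚ.<-≤-trans 0<termⱼ (subst (ℚ._≤ lambdaB b N) (lookup-λ-terms j) (lookup≤maxℚ λ-terms j))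
    where
    j = proj₁ (≢0ᵛ⇒lookup≢0 b b≢0)
    0<termⱼ : 0ℚ ℚ.< ℕtoℚ ∣ lookup b j ∣ ÷' ℕtoℚ (gcdVec b ℕ.* lookup N j)
    0<termⱼ = ÷'-pos (ℕtoℚ-pos (gcdVec*lookup≢0 b≢0 (N≥1 j))) (ℕtoℚ-pos (proj₂ (≢0ᵛ⇒lookup≢0 b b≢0) ∘ ℤ.∣i∣≡0⇒i≡0))

  lambdaB-attained : 0ℚ ℚ.< lambdaB b N →
    Σ (Fin n) λ i → lookup b i ≢ + 0 × lambdaB b N ≡ ℕtoℚ ∣ lookup b i ∣ ÷' ℕtoℚ (gcdVec b ℕ.* lookup N i)
  lambdaB-attained 0<λ = i , bᵢ≢0 , λ≡termᵢ
    where
    i = proj₁ (maxℚ-attained λ-terms 0<λ)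
    Q = ℕtoℚ (gcdVec b ℕ.* lookup N i)
    λ≡termᵢ : lambdaB b N ≡ ℕtoℚ ∣ lookup b i ∣ ÷' Q
    λ≡termᵢ = trans (proj₂ (maxℚ-attained λ-terms 0<λ)) (lookup-λ-terms i)
    bᵢ≢0 : lookup b i ≢ + 0
    bᵢ≢0 bᵢ≡0 = ℚ.<⇒≢ 0<λ (sym (begin
      lambdaB b N                  ≡⟨ λ≡termᵢ ⟩
      ℕtoℚ ∣ lookup b i ∣ ÷' Q     ≡⟨ cong (λ z → ℕtoℚ ∣ z ∣ ÷' Q) bᵢ≡0 ⟩
      0ℚ ÷' Q                      ≡⟨ 0÷'q≡0 Q ⟩
      0ℚ                           ∎))
      where open ≡-Reasoning

-- Lines in a box

RatMultiple⇒cross : ∀ {n} {w b : Pt n} → RatMultiple w b → ∀ i j → lookup w j ℤ.* lookup b i ≡ lookup w i ℤ.* lookup b j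
RatMultiple⇒cross {w = w} {b} (k , w≡kb) i j = toℚ-injective (begin
  toℚ (wⱼ ℤ.* bᵢ)              ≡⟨ toℚ-* wⱼ bᵢ ⟩
  toℚ wⱼ ℚ.* toℚ bᵢ            ≡⟨ cong (ℚ._* toℚ bᵢ) (toℚ-lookup j) ⟩
  k ℚ.* toℚ bⱼ ℚ.* toℚ bᵢ      ≡⟨ ℚ.*-assoc k (toℚ bⱼ) (toℚ bᵢ) ⟩
  k ℚ.* (toℚ bⱼ ℚ.* toℚ bᵢ)    ≡⟨ cong (k ℚ.*_) (ℚ.*-comm (toℚ bⱼ) (toℚ bᵢ)) ⟩
  k ℚ.* (toℚ bᵢ ℚ.* toℚ bⱼ)    ≡⟨ ℚ.*-assoc k (toℚ bᵢ) (toℚ bⱼ) ⟨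
  k ℚ.* toℚ bᵢ ℚ.* toℚ bⱼ      ≡⟨ cong (ℚ._* toℚ bⱼ) (toℚ-lookup i) ⟨
  toℚ wᵢ ℚ.* toℚ bⱼ            ≡⟨ toℚ-* wᵢ bⱼ ⟨
  toℚ (wᵢ ℤ.* bⱼ)              ∎)
  where
  open ≡-Reasoning
  wᵢ = lookup w i; wⱼ = lookup w j; bᵢ = lookup b i; bⱼ = lookup b j
  toℚ-lookup : ∀ l → toℚ (lookup w l) ≡ k ℚ.* toℚ (lookup b l)
  toℚ-lookup l = begin
    toℚ (lookup w l)                          ≡⟨ Vec.lookup-map l toℚ w ⟨
    lookup (Vec.map toℚ w) l                  ≡⟨ cong (λ u → lookup u l) w≡kb ⟩
    lookup (Vec.map (k ℚ.*_) (Vec.map toℚ b)) l ≡⟨ Vec.lookup-map l (k ℚ.*_) (Vec.map toℚ b) ⟩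
    k ℚ.* lookup (Vec.map toℚ b) l            ≡⟨ cong (k ℚ.*_) (Vec.lookup-map l toℚ b) ⟩
    k ℚ.* toℚ (lookup b l)                    ∎

RatMultiple-lookup≡0 : ∀ {n} {w b : Pt n} i → lookup b i ≢ + 0 → RatMultiple w b → lookup w i ≡ + 0 → w ≡ 0ᵛ
RatMultiple-lookup≡0 {w = w} {b} i bᵢ≢0 w∥b wᵢ≡0 = begin
  w                        ≡⟨ Vec.tabulate∘lookup w ⟨
  Vec.tabulate (lookup w)  ≡⟨ Vec.tabulate-cong wⱼ≡0 ⟩
  Vec.tabulate (lookup 0ᵛ) ≡⟨ Vec.tabulate∘lookup 0ᵛ ⟩
  0ᵛ                       ∎
  where
  open ≡-Reasoning
  wⱼ≡0 : ∀ j → lookup w j ≡ lookup 0ᵛ j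
  wⱼ≡0 j with ℤ.i*j≡0⇒i≡0∨j≡0 (lookup w j) (trans (RatMultiple⇒cross w∥b i j) (cong (ℤ._* lookup b j) wᵢ≡0))
  ... | inj₁ wⱼ≡0 = trans wⱼ≡0 (sym (Vec.lookup-replicate j (+ 0)))
  ... | inj₂ bᵢ≡0 = contradiction bᵢ≡0 bᵢ≢0

-- From w ∥ b, |bᵢ| divides |wᵢ| |bⱼ| for every j, hence |wᵢ| gcd(b); that is, w is an
-- integral multiple of b / gcd(b).
RatMultiple⇒∣ : ∀ {n} {w b : Pt n} i β → β ℕ.* gcdVec b ≡ ∣ lookup b i ∣ → gcdVec b ≢ 0 → RatMultiple w b →
                β ∣ ∣ lookup w i ∣
RatMultiple⇒∣ {w = w} {b} i β βg≡∣bᵢ∣ g≢0 w∥b = ℕ.*-cancelʳ-∣ (gcdVec b) {{ℕ.≢-nonZero g≢0}}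
  (subst (_∣ ∣ lookup w i ∣ ℕ.* gcdVec b) (sym βg≡∣bᵢ∣) (∣-*-gcdVec b ∣ lookup w i ∣ ∣bᵢ∣∣∣wᵢ∣∣bⱼ∣))
  where
  ∣bᵢ∣∣∣wᵢ∣∣bⱼ∣ : ∀ j → ∣ lookup b i ∣ ∣ ∣ lookup w i ∣ ℕ.* ∣ lookup b j ∣
  ∣bᵢ∣∣∣wᵢ∣∣bⱼ∣ j = divides ∣ lookup w j ∣ (begin
    ∣ lookup w i ∣ ℕ.* ∣ lookup b j ∣    ≡⟨ ℤ.abs-* (lookup w i) (lookup b j) ⟨
    ∣ lookup w i ℤ.* lookup b j ∣        ≡⟨ cong ∣_∣ (RatMultiple⇒cross w∥b i j) ⟨
    ∣ lookup w j ℤ.* lookup b i ∣        ≡⟨ ℤ.abs-* (lookup w j) (lookup b i) ⟩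
    ∣ lookup w j ∣ ℕ.* ∣ lookup b i ∣    ∎)
    where open ≡-Reasoning

/-injective-on-∣∸ : ∀ β .{{_ : NonZero β}} {m n} → m ≤ n → β ∣ n ∸ m → m / β ≡ n / β → m ≡ n
/-injective-on-∣∸ β {m} {n} m≤n β∣n∸m m/β≡n/β = ℕ.≤-antisym m≤n (ℕ.m∸n≡0⇒m≤n n∸m≡0)
  where
  [n∸m]/β≡0 : (n ∸ m) / β ≡ 0
  [n∸m]/β≡0 = ℕ.+-cancelˡ-≡ (m / β) _ 0 (begin
    m / β ℕ.+ (n ∸ m) / β  ≡⟨ +-distrib-/-∣ʳ m β∣n∸m ⟨
    (m ℕ.+ (n ∸ m)) / β    ≡⟨ cong (_/ β) (ℕ.m+[n∸m]≡n m≤n) ⟩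
    n / β                  ≡⟨ m/β≡n/β ⟨
    m / β                  ≡⟨ ℕ.+-identityʳ (m / β) ⟨
    m / β ℕ.+ 0            ∎)
    where open ≡-Reasoning
  n∸m≡0 : n ∸ m ≡ 0
  n∸m≡0 = trans (sym (m/n*n≡m β∣n∸m)) (cong (ℕ._* β) [n∸m]/β≡0)

/-injective-mod : ∀ β .{{_ : NonZero β}} {m n} → β ∣ ∣ m ⊖ n ∣ → m / β ≡ n / β → m ≡ n
/-injective-mod β {m} {n} β∣m⊖n m/β≡n/β with ℕ.≤-total m n
... | inj₁ m≤n = /-injective-on-∣∸ β m≤n (subst (β ∣_) (ℤ.∣⊖∣-≤ m≤n) β∣m⊖n) m/β≡n/β
... | inj₂ n≤m = sym (/-injective-on-∣∸ β n≤m
  (subst (β ∣_) (trans (ℤ.∣m⊖n∣≡∣n⊖m∣ m n) (ℤ.∣⊖∣-≤ n≤m)) β∣m⊖n) (sym m/β≡n/β))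

pairwise-congruent-length≤ : ∀ β .{{_ : NonZero β}} K {ns} → Unique ns → All (_≤ K) ns →
                             (∀ {m n} → m ∈ ns → n ∈ ns → β ∣ ∣ m ⊖ n ∣) → length ns ≤ suc (K / β)
pairwise-congruent-length≤ β K {ns} ns! ns≤K ns≡mod = begin
  length ns                    ≡⟨ List.length-map (_/ β) ns ⟨
  length (List.map (_/ β) ns)  ≤⟨ Unique-⊆⇒length≤ (Unique-map⁺-on (_/ β) (λ m∈ n∈ → /-injective-mod β (ns≡mod m∈ n∈)) ns!) quotients≤K/β ⟩
  length (upTo (suc (K / β)))  ≡⟨ List.length-upTo (suc (K / β)) ⟩
  suc (K / β)                  ∎
  where
  open ℕ.≤-Reasoning
  quotients≤K/β : ∀ {q} → q ∈ List.map (_/ β) ns → q ∈ upTo (suc (K / β))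
  quotients≤K/β q∈ with ∈-map⁻ (_/ β) q∈
  ... | n , n∈ns , refl = ∈-upTo⁺ (ℕ.s≤s (/-monoˡ-≤ β (All.lookup ns≤K n∈ns)))

InBox-lookup : ∀ {n} {N : Vec ℕ n} {x : Pt n} → InBox N x → ∀ i → + 1 ℤ.≤ lookup x i × lookup x i ℤ.≤ + lookup N i
InBox-lookup {N = _ ∷ _} {_ ∷ _} (xᵢ∈[1,Nᵢ] , _) zero    = xᵢ∈[1,Nᵢ]
InBox-lookup {N = _ ∷ _} {_ ∷ _} (_ , x∈box)     (suc i) = InBox-lookup x∈box i

module _ {n} (b : Pt n) (N : Vec ℕ n) (i : Fin n) (bᵢ≢0 : lookup b i ≢ + 0)
         (β : ℕ) .{{_ : NonZero β}} (βg≡∣bᵢ∣ : β ℕ.* gcdVec b ≡ ∣ lookup b i ∣) where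

  line∩box-length≤ : ∀ {F} → Unique F → (∀ {x} → x ∈ F → InBox N x) →
                     (∀ {x y} → x ∈ F → y ∈ F → RatMultiple (x -ᵛ y) b) → length F ≤ suc (lookup N i / β)
  line∩box-length≤ {F} F! F⊆box F∥b = subst (_≤ suc (lookup N i / β)) (List.length-map coord F)
    (pairwise-congruent-length≤ β (lookup N i) (Unique-map⁺-on coord coord-inj F!) (AllP.map⁺ (All.tabulate coord≤Nᵢ)) coords-congruent)
    where
    coord : Pt n → ℕ
    coord x = ∣ lookup x i ∣
    +coord : ∀ {x} → x ∈ F → + coord x ≡ lookup x i
    +coord x∈F = ℤ.0≤i⇒+∣i∣≡i (ℤ.≤-trans (ℤ.+≤+ ℕ.z≤n) (proj₁ (InBox-lookup (F⊆box x∈F) i)))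
    coord-inj : ∀ {x y} → x ∈ F → y ∈ F → coord x ≡ coord y → x ≡ y
    coord-inj {x} {y} x∈F y∈F cx≡cy = x-ᵛy≡0ᵛ⇒x≡y (RatMultiple-lookup≡0 i bᵢ≢0 (F∥b x∈F y∈F) (begin
      lookup (x -ᵛ y) i         ≡⟨ Vec.lookup-zipWith ℤ._-_ i x y ⟩
      lookup x i ℤ.- lookup y i ≡⟨ cong₂ ℤ._-_ (trans (sym (+coord x∈F)) (cong +_ cx≡cy)) (sym (+coord y∈F)) ⟩
      + coord y ℤ.- + coord y   ≡⟨ ℤ.+-inverseʳ (+ coord y) ⟩
      + 0                       ∎))
      where open ≡-Reasoning
    coord≤Nᵢ : ∀ {x} → x ∈ F → coord x ≤ lookup N i
    coord≤Nᵢ x∈F = ℤ.drop‿+≤+ (subst (ℤ._≤ + lookup N i) (sym (+coord x∈F)) (proj₂ (InBox-lookup (F⊆box x∈F) i)))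
    coords-congruent : ∀ {m m'} → m ∈ List.map coord F → m' ∈ List.map coord F → β ∣ ∣ m ⊖ m' ∣
    coords-congruent m∈ m'∈ with ∈-map⁻ coord m∈ | ∈-map⁻ coord m'∈
    ... | x , x∈F , refl | y , y∈F , refl = subst (β ∣_) ∣[x-y]ᵢ∣≡ (RatMultiple⇒∣ i β βg≡∣bᵢ∣ g≢0 (F∥b x∈F y∈F))
      where
      g≢0 : gcdVec b ≢ 0
      g≢0 g≡0 = bᵢ≢0 (ℤ.∣i∣≡0⇒i≡0 (trans (sym βg≡∣bᵢ∣) (trans (cong (β ℕ.*_) g≡0) (ℕ.*-zeroʳ β))))
      ∣[x-y]ᵢ∣≡ : ∣ lookup (x -ᵛ y) i ∣ ≡ ∣ coord x ⊖ coord y ∣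
      ∣[x-y]ᵢ∣≡ = cong ∣_∣ (begin
        lookup (x -ᵛ y) i         ≡⟨ Vec.lookup-zipWith ℤ._-_ i x y ⟩
        lookup x i ℤ.- lookup y i ≡⟨ cong₂ ℤ._-_ (+coord x∈F) (+coord y∈F) ⟨
        + coord x ℤ.- + coord y   ≡⟨ ℤ.[+m]-[+n]≡m⊖n (coord x) (coord y) ⟩
        coord x ⊖ coord y         ∎)
        where open ≡-Reasoning

suc[n/β]*β≤2n : ∀ β .{{_ : NonZero β}} {n} → β ≤ n → suc (n / β) ℕ.* β ≤ 2 ℕ.* n
suc[n/β]*β≤2n β {n} β≤n = ℕ.+-mono-≤ β≤n (ℕ.≤-trans (m/n*n≤m n β) (ℕ.m≤m+n n 0))

line∩box-bound : ∀ {n} (b : Pt n) (N : Vec ℕ n) → b ≢ 0ᵛ → (∀ i → 1 ≤ lookup N i) → lambdaB b N ℚ.≤ 1ℚ →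
  Σ ℕ λ m → ℕtoℚ m ℚ.≤ ℕtoℚ 2 ÷' lambdaB b N ×
    (∀ {F} → Unique F → (∀ {x} → x ∈ F → InBox N x) → (∀ {x y} → x ∈ F → y ∈ F → RatMultiple (x -ᵛ y) b) → length F ≤ m)
line∩box-bound b N b≢0 N≥1 λ≤1 = suc (Nᵢ / β) , m≤2/λ , line∩box-length≤ b N i bᵢ≢0 β βg≡∣bᵢ∣
  where
  0<λ = lambdaB-pos b N b≢0 N≥1
  i = proj₁ (lambdaB-attained b N 0<λ)
  bᵢ≢0 = proj₁ (proj₂ (lambdaB-attained b N 0<λ))
  g = gcdVec b
  Nᵢ = lookup N i
  ∣bᵢ∣ = ∣ lookup b i ∣
  Q = ℕtoℚ (g ℕ.* Nᵢ)
  λ≡∣bᵢ∣/Q : lambdaB b N ≡ ℕtoℚ ∣bᵢ∣ ÷' Q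
  λ≡∣bᵢ∣/Q = proj₂ (proj₂ (lambdaB-attained b N 0<λ))
  0<Q : 0ℚ ℚ.< Q
  0<Q = ℕtoℚ-pos (gcdVec*lookup≢0 b N b≢0 (N≥1 i))
  instance
    g-nonZero : NonZero g
    g-nonZero = ℕ.≢-nonZero (b≢0 ∘ gcdVec≡0⇒≡0ᵛ b)
  ∣bᵢ∣≤gNᵢ : ∣bᵢ∣ ≤ g ℕ.* Nᵢ
  ∣bᵢ∣≤gNᵢ = ℕtoℚ-cancel-≤ (subst (ℕtoℚ ∣bᵢ∣ ℚ.≤_) (ℚ.*-identityˡ Q) (÷'≤⇒≤* 0<Q (subst (ℚ._≤ 1ℚ) λ≡∣bᵢ∣/Q λ≤1)))
  β = ∣bᵢ∣ / g
  βg≡∣bᵢ∣ : β ℕ.* g ≡ ∣bᵢ∣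
  βg≡∣bᵢ∣ = m/n*n≡m (gcdVec-∣-lookup b i)
  instance
    β-nonZero : NonZero β
    β-nonZero = ℕ.≢-nonZero λ β≡0 → bᵢ≢0 (ℤ.∣i∣≡0⇒i≡0 (trans (sym βg≡∣bᵢ∣) (cong (ℕ._* g) β≡0)))
  β≤Nᵢ : β ≤ Nᵢ
  β≤Nᵢ = ℕ.*-cancelʳ-≤ β Nᵢ g (subst₂ _≤_ (sym βg≡∣bᵢ∣) (ℕ.*-comm g Nᵢ) ∣bᵢ∣≤gNᵢ)
  ∣bᵢ∣m≤2gNᵢ : ∣bᵢ∣ ℕ.* suc (Nᵢ / β) ≤ 2 ℕ.* (g ℕ.* Nᵢ)
  ∣bᵢ∣m≤2gNᵢ = begin
    ∣bᵢ∣ ℕ.* m          ≡⟨ cong (ℕ._* m) βg≡∣bᵢ∣ ⟨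
    β ℕ.* g ℕ.* m       ≡⟨ ℕ.*-comm (β ℕ.* g) m ⟩
    m ℕ.* (β ℕ.* g)     ≡⟨ ℕ.*-assoc m β g ⟨
    m ℕ.* β ℕ.* g       ≤⟨ ℕ.*-monoˡ-≤ g (suc[n/β]*β≤2n β β≤Nᵢ) ⟩
    2 ℕ.* Nᵢ ℕ.* g      ≡⟨ ℕ.*-assoc 2 Nᵢ g ⟩
    2 ℕ.* (Nᵢ ℕ.* g)    ≡⟨ cong (2 ℕ.*_) (ℕ.*-comm Nᵢ g) ⟩
    2 ℕ.* (g ℕ.* Nᵢ)    ∎
    where
    open ℕ.≤-Reasoning
    m = suc (Nᵢ / β)
  m≤2/λ : ℕtoℚ (suc (Nᵢ / β)) ℚ.≤ ℕtoℚ 2 ÷' lambdaB b N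
  m≤2/λ = *≤⇒≤÷' 0<λ (begin
    ℕtoℚ m ℚ.* lambdaB b N                ≡⟨ cong (ℕtoℚ m ℚ.*_) λ≡∣bᵢ∣/Q ⟩
    ℕtoℚ m ℚ.* (ℕtoℚ ∣bᵢ∣ ÷' Q)           ≡⟨ ℚ.*-comm (ℕtoℚ m) _ ⟩
    (ℕtoℚ ∣bᵢ∣ ÷' Q) ℚ.* ℕtoℚ m           ≡⟨ ÷'-*-comm 0<Q (ℕtoℚ ∣bᵢ∣) (ℕtoℚ m) ⟩
    (ℕtoℚ ∣bᵢ∣ ℚ.* ℕtoℚ m) ÷' Q           ≤⟨ ≤*⇒÷'≤ 0<Q (begin
      ℕtoℚ ∣bᵢ∣ ℚ.* ℕtoℚ m                   ≡⟨ ℕtoℚ-* ∣bᵢ∣ m ⟨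
      ℕtoℚ (∣bᵢ∣ ℕ.* m)                      ≤⟨ ℕtoℚ-mono-≤ ∣bᵢ∣m≤2gNᵢ ⟩
      ℕtoℚ (2 ℕ.* (g ℕ.* Nᵢ))                ≡⟨ ℕtoℚ-* 2 (g ℕ.* Nᵢ) ⟩
      ℕtoℚ 2 ℚ.* Q                          ∎) ⟩
    ℕtoℚ 2                                ∎)
    where
    open ℚ.≤-Reasoning
    m = suc (Nᵢ / β)

module _ {m n} (M : Mat m n) (v : Pt m) {b : Pt n} {N : Vec ℕ n} {k : ℕ}
         (fibre-∥ : ∀ x y → affine M v x ≡ affine M v y → RatMultiple (x -ᵛ y) b)
         (line∩box≤k : ∀ {F} → Unique F → (∀ {x} → x ∈ F → InBox N x) →
                       (∀ {x y} → x ∈ F → y ∈ F → RatMultiple (x -ᵛ y) b) → length F ≤ k) where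

  good-points-bound : ∀ {xs ys} → Unique xs → (∀ {x} → x ∈ xs → InBox N x) → (∀ {x} → x ∈ xs → affine M v x ∈ ys) →
                      length xs ≤ k * length ys
  good-points-bound {xs} {ys} xs! xs⊆box f[xs]⊆ys = length≤fibre*length _≟ᵛ_ (affine M v) xs ys f[xs]⊆ys λ z →
    line∩box≤k (Unique.filter⁺ (fx≟ z) xs!)
      (λ x∈fibre → xs⊆box (proj₁ (∈-filter⁻ (fx≟ z) {xs = xs} x∈fibre)))
      (λ {x} {y} x∈fibre y∈fibre → fibre-∥ x y (trans (proj₂ (∈-filter⁻ (fx≟ z) {xs = xs} x∈fibre))
                                                  (sym (proj₂ (∈-filter⁻ (fx≟ z) {xs = xs} y∈fibre)))))
    where
    fx≟ = λ z x → affine M v x ≟ᵛ z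

-- Points of U

InU-resp-CongMod : ∀ {k} {Y : Pt k → Set} {b s y y′} → InU Y b s y → Y y′ → CongMod b y′ y → InU Y b s y′
InU-resp-CongMod (_ , L , L! , L~y , s≤|L|) Yy′ y′~y =
  Yy′ , L , L! , All.map (λ (Yz , z~y) → Yz , CongMod-trans z~y (CongMod-sym y′~y)) L~y , s≤|L|

module _ {m n} (M : Mat m n) (v : Pt m) {b : Pt n} (fb≢f0 : affine M v b ≢ affine M v 0ᵛ) where

  open import Data.List.Membership.DecPropositional (_≟ᵛ_ {n}) using (_∈?_)

  affine-class-InU : ∀ {Z : Pt n → Set} {s x₀ F} → Unique F → All (λ x → Z x × CongMod b x x₀) F → s ≤ length F → Z x₀ →
                     InU (Image (affine M v) Z) (affine M v b -ᵛ affine M v 0ᵛ) s (affine M v x₀)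
  affine-class-InU {s = s} {x₀} {F} F! F~x₀ s≤|F| Zx₀ =
    (x₀ , Zx₀ , refl) ,
    map (affine M v) F ,
    Unique-map⁺-on (affine M v) (λ x∈F y∈F → affine-injective-on-CongMod M v fb≢f0 (x~y x∈F y∈F)) F! ,
    AllP.map⁺ (All.map (λ {x} (Zx , x~x₀) → (x , Zx , refl) , affine-CongMod M v x~x₀) F~x₀) ,
    subst (s ≤_) (sym (List.length-map (affine M v) F)) s≤|F|
    where
    x~y : ∀ {x y} → x ∈ F → y ∈ F → CongMod b x y
    x~y x∈F y∈F = CongMod-trans (proj₂ (All.lookup F~x₀ x∈F)) (CongMod-sym (proj₂ (All.lookup F~x₀ y∈F)))

  -- f is injective on the class and maps it into one class of f(Z) mod f(b) − f(0).
  class-outside-U-length≤ : ∀ {Z : Pt n → Set} {s* y F} → Unique F →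
                            All (λ x → Z x × CongMod b y x × ¬ InU (Image (affine M v) Z) (affine M v b -ᵛ affine M v 0ᵛ) s* (affine M v x)) F →
                            length F ≤ s* ∸ 1
  class-outside-U-length≤ {F = []} _ _ = z≤n
  class-outside-U-length≤ {s* = s*} {F = x₀ ∷ F} F! F-ok with s* ℕ.≤? length (x₀ ∷ F)
  ... | no  s*≰|F| = ℕ.∸-monoˡ-≤ 1 (ℕ.≰⇒> s*≰|F|)
  ... | yes s*≤|F| with All.head F-ok
  ...   | Zx₀ , y~x₀ , fx₀∉ = contradiction (affine-class-InU F! ok⇒~x₀ s*≤|F| Zx₀) fx₀∉
    where ok⇒~x₀ = All.map (λ (Zx , y~x , _) → Zx , CongMod-trans (CongMod-sym y~x) y~x₀) F-ok

  bad-points-bound : ∀ {Y Z : Pt n → Set} {s s* xs ys} → Unique xs →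
    (∀ {x} → x ∈ xs → Z x × InU Y b s x × ¬ InU (Image (affine M v) Z) (affine M v b -ᵛ affine M v 0ᵛ) s* (affine M v x)) →
    (∀ {y} → InU Y b s y → y ∈ ys) → s * length xs ≤ (s* ∸ 1) * length ys
  bad-points-bound {Y} {Z} {s} {s*} {xs} {ys} xs! bad U⊆ys = incidence-bound R? xs ys s≤degree codegree≤s*-1
    where
    witnesses = choice-on-list _≟ᵛ_ {P = λ x L → Unique L × All (λ y → Y y × CongMod b y x) L × s ≤ length L} []
                  (λ x∈xs → proj₂ (proj₁ (proj₂ (bad x∈xs))))
    W = proj₁ witnesses
    R? = λ x y → y ∈? W x
    s≤degree : ∀ {x} → x ∈ xs → s ≤ length (filter (R? x) ys)
    s≤degree {x} x∈xs with proj₂ witnesses x∈xs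
    ... | W! , W~x , s≤|W| = ℕ.≤-trans s≤|W| (Unique-⊆⇒length≤ W! λ z∈W →
      let (Yz , z~x) = All.lookup W~x z∈W in ∈-filter⁺ (R? x) (U⊆ys (InU-resp-CongMod (proj₁ (proj₂ (bad x∈xs))) Yz z~x)) z∈W)
    codegree≤s*-1 : ∀ {y} → y ∈ ys → length (filter (λ x → R? x y) xs) ≤ s* ∸ 1
    codegree≤s*-1 {y} _ = class-outside-U-length≤ (Unique.filter⁺ _ xs!) (All.tabulate λ x∈F →
      let (x∈xs , y∈Wx) = ∈-filter⁻ (λ x → R? x y) x∈F
          (Zx , _ , fx∉) = bad x∈xs
      in Zx , proj₂ (All.lookup (proj₁ (proj₂ (proj₂ witnesses x∈xs))) y∈Wx) , fx∉)

lemma4p7 : (d : ℕ) → 2 ≤ d → (N : Vec ℕ d) → (∀ i → 1 ≤ lookup N i) →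
    (X : List (Pt d)) → (∀ x → x ∈ X → InBox N x) →
    (b : Pt d) → b ≢ 0ᵛ → lambdaB b N ℚ.≤ ℚ.1ℚ →
    (s* s : ℕ) → 1 ≤ s* → s* ≤ s → (∀ i → s ≤ lookup N i) →
    (M : Mat (d ∸ 1) d) → (v : Pt (d ∸ 1)) →
    (∀ x₁ x₂ → (affine M v x₁ ≡ affine M v x₂) ⇔ RatMultiple (x₁ -ᵛ x₂) b) →
    (b' : Pt d) → affine M v b' ≢ affine M v 0ᵛ →
    (nA nB nC : ℕ) →
    HasCard (λ x → InU (_∈ X) b s x × InU (_∈ X) b' s x) nA →
    HasCard (InU (_∈ X) b' s) nB →
    HasCard (InU (Image (affine M v) (InU (_∈ X) b s))
                 (affine M v b' -ᵛ affine M v 0ᵛ) s*) nC →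
    ℕtoℚ nA ℚ.≤
      (ℕtoℚ (s* ∸ 1) ÷' ℕtoℚ s) ℚ.* ℕtoℚ nB
      ℚ.+ (ℕtoℚ 2 ÷' lambdaB b N) ℚ.* ℕtoℚ nC
lemma4p7 d _ N N≥1 X X⊆box b b≢0 λ≤1 s* s s*≥1 s*≤s _ M v f≡⇔∥b b′ fb′≢f0 _ _ _
         (LA , LA! , LA⇔ , refl) (LB , _ , LB⇔ , refl) (LC , _ , LC⇔ , refl) = begin
  ℕtoℚ (length LA)                           ≡⟨ cong ℕtoℚ (length-filter+filter-∁ fx∈LC? LA) ⟩
  ℕtoℚ (length Good + length Bad)            ≡⟨ ℕtoℚ-+ (length Good) (length Bad) ⟩
  ℕtoℚ (length Good) ℚ.+ ℕtoℚ (length Bad)   ≡⟨ ℚ.+-comm (ℕtoℚ (length Good)) (ℕtoℚ (length Bad)) ⟩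
  ℕtoℚ (length Bad) ℚ.+ ℕtoℚ (length Good)   ≤⟨ ℚ.+-mono-≤ (ℕtoℚ-≤-÷'* {length Bad} {s} {s* ∸ 1} {length LB} s≢0 bad)
                                                            (ℕtoℚ-≤-* {length Good} {m} {length LC} good m≤2/λ) ⟩
  (ℕtoℚ (s* ∸ 1) ÷' ℕtoℚ s) ℚ.* ℕtoℚ (length LB) ℚ.+ (ℕtoℚ 2 ÷' lambdaB b N) ℚ.* ℕtoℚ (length LC) ∎
  where
  open ℚ.≤-Reasoning
  open import Data.List.Membership.DecPropositional (_≟ᵛ_ {d ∸ 1}) using (_∈?_)
  fx∈LC? = λ x → affine M v x ∈? LC
  Good = filter fx∈LC? LA
  Bad  = filter (∁? fx∈LC?) LA
  m = proj₁ (line∩box-bound b N b≢0 N≥1 λ≤1)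
  m≤2/λ = proj₁ (proj₂ (line∩box-bound b N b≢0 N≥1 λ≤1))
  s≢0 = ℕ.m<n⇒n≢0 (ℕ.<-≤-trans s*≥1 s*≤s)
  good : length Good ≤ m * length LC
  good = good-points-bound M v (λ x y → to (f≡⇔∥b x y)) (proj₂ (proj₂ (line∩box-bound b N b≢0 N≥1 λ≤1)))
    (Unique.filter⁺ fx∈LC? LA!)
    (λ x∈Good → X⊆box _ (proj₁ (proj₁ (to (LA⇔ _) (proj₁ (∈-filter⁻ fx∈LC? {xs = LA} x∈Good))))))
    (λ x∈Good → proj₂ (∈-filter⁻ fx∈LC? {xs = LA} x∈Good))
  bad : s * length Bad ≤ (s* ∸ 1) * length LB
  bad = bad-points-bound M v fb′≢f0 (Unique.filter⁺ (∁? fx∈LC?) LA!)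
    (λ x∈Bad → let (x∈LA , fx∉LC) = ∈-filter⁻ (∁? fx∈LC?) {xs = LA} x∈Bad
                   (x∈U , x∈U′)   = to (LA⇔ _) x∈LA
               in x∈U , x∈U′ , fx∉LC ∘ from (LC⇔ _))
    (from (LB⇔ _))
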